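{- Let $k,m,n\ge1$, $1\le l\le m$, let $\mu$ be a measure on $[k]$, and for $1\le i\le n$ let $a^i_1,\dots,a^i_m\subseteq[k]$. Then $$e_l\Big(\bigcup_{i=1}^n\{a^i_1,\dots,a^i_m\}\Big)=\frac{1}{(m!)^{n-1}}\sum_{\substack{\sigma\in\{\mathrm{id}\}\times S_m^{n-1}\\ 1\le t_1<t_2<\cdots<t_l\le m\\ f:[l]\to P([n])\setminus\{\emptyset\}}}\ \prod_{j=1}^{l}(-1)^{|f(j)|+1}\,\mu\Big(\bigcap_{i\in f(j)}a^i_{\sigma_i(t_j)}\Big),$$ where $\sigma=(\sigma_1,\dots,\sigma_n)$ with $\sigma_1=\mathrm{id}$.
   Context: Work over $\mathbb{R}$. $[k]=\{1,\dots,k\}$; $\langle P[k]\rangle$ is the real vector space with basis the subsets of $[k]$, with union the bilinear extension of set union; $\langle P[k]\rangle^{\otimes m}$ has componentwise union and $S_m$ permutes tensor factors. $\mathrm{Sym}^m\langle P[k]\rangle=\langle P[k]\rangle^{\otimes m}/S_m$ (coinvariants), $\{a_1,\dots,a_m\}$ denotes the class of $a_1\otimes\cdots\otimes a_m$, union on it is $\bar u\cup\bar v=\frac{1}{m!}\sum_{\tau\in S_m}\overline{u\cup\tau v}$, and $\bigcup_{i=1}^n$ is the iterated union. A measure on $[k]$ is a map $\mu:P([k])\to\mathbb{R}$ with $\mu(a\cup b)=\mu(a)+\mu(b)$ for disjoint $a,b$. The elementary symmetric function is $e_l(x_1,\dots,x_m)=\sum_{1\le t_1<\cdots<t_l\le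 m}\prod_{j=1}^l x_{t_j}$, and $e_l:\mathrm{Sym}^m\langle P[k]\rangle\to\mathbb{R}$ is the linear map with $e_l(\{a_1,\dots,a_m\})=e_l(\mu(a_1),\dots,\mu(a_m))$. -}

module Defs where

open import Level using (Level)
open import Algebra.Bundles using (CommutativeRing)
open import Data.Nat using (ℕ; zero; suc)
open import Data.Fin using (Fin; zero; suc; _<_)
open import Data.Fin.Properties using (all?; _<?_; _≟_)
open import Data.Fin.Subset using (Subset; _∪_; _∩_; ⋂; ∣_∣; Nonempty; _∈_; ⊥)
open import Data.Fin.Subset.Properties using (nonempty?; _∈?_)
open import Data.List using (List; []; _∷_; [_]; map; concatMap; filter; foldr; _++_; allFin)
open import Data.Vec using ([]; _∷_)
open import Data.Bool using (true; false)
open import Data.Product using (_×_; _,_)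
open import Relation.Binary.PropositionalEquality using (_≡_)
open import Relation.Nullary.Decidable using (Dec; _→-dec_)

allSubsets : (n : ℕ) → List (Subset n)
allSubsets zero    = [ [] ]
allSubsets (suc n) = map (true ∷_) (allSubsets n) ++ map (false ∷_) (allSubsets n)

nonemptySubsets : (n : ℕ) → List (Subset n)
nonemptySubsets n = filter nonempty? (allSubsets n)

allFuns : ∀ {a} {A : Set a} (l : ℕ) → List A → List (Fin l → A)
allFuns zero    xs = [ (λ ()) ]
allFuns (suc l) xs =
  concatMap (λ x → map (λ g → λ { zero → x ; (suc j) → g j }) (allFuns l xs)) xs

Increasing : ∀ {l m} → (Fin l → Fin m) → Set
Increasing t = ∀ i j → i < j → t i < t j

increasing? : ∀ {l m} (t : Fin l → Fin m) → Dec (Increasing t)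
increasing? t = all? λ i → all? λ j → (i <? j) →-dec (t i <? t j)

increasingTuples : (l m : ℕ) → List (Fin l → Fin m)
increasingTuples l m = filter increasing? (allFuns l (allFin m))

-- the symmetric group S_m, as the (bijective = injective) maps Fin m → Fin m
IsPerm : ∀ {m} → (Fin m → Fin m) → Set
IsPerm τ = ∀ i j → τ i ≡ τ j → i ≡ j

isPerm? : ∀ {m} (τ : Fin m → Fin m) → Dec (IsPerm τ)
isPerm? τ = all? λ i → all? λ j → (τ i ≟ τ j) →-dec (i ≟ j)

perms : (m : ℕ) → List (Fin m → Fin m)
perms m = filter isPerm? (allFuns m (allFin m))

sigmas : (n m : ℕ) → List (Fin n → Fin m → Fin m)
sigmas zero    m = [ (λ ()) ]
sigmas (suc p) m =
  map (λ ρ → λ { zero → (λ t → t) ; (suc i) → ρ i }) (allFuns p (perms m))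

elems : ∀ {n} → Subset n → List (Fin n)
elems {n} s = filter (_∈? s) (allFin n)

-- Everything over a commutative ring of scalars R (ℝ in the paper)

module Over {c ℓ : Level} (R : CommutativeRing c ℓ) where
  open CommutativeRing R public using (Carrier; _≈_; _+_; _*_; -_; 0#; 1#)

  ΣL : ∀ {a} {A : Set a} → List A → (A → Carrier) → Carrier
  ΣL xs f = foldr (λ x acc → f x + acc) 0# xs

  ΠL : ∀ {a} {A : Set a} → List A → (A → Carrier) → Carrier
  ΠL xs f = foldr (λ x acc → f x * acc) 1# xs

  nat : ℕ → Carrier
  nat zero    = 0#
  nat (suc n) = 1# + nat n

  _^_ : Carrier → ℕ → Carrier
  x ^ zero  = 1#
  x ^ suc n = x * (x ^ n)

  sgn : ℕ → Carrier
  sgn zero    = 1#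
  sgn (suc n) = - sgn n

  IsMeasure : ∀ {k} → (Subset k → Carrier) → Set ℓ
  IsMeasure μ = ∀ a b → a ∩ b ≡ ⊥ → μ (a ∪ b) ≈ μ a + μ b

  esym : ∀ {m} (l : ℕ) → (Fin m → Carrier) → Carrier
  esym {m} l x = ΣL (increasingTuples l m) λ t → ΠL (allFin l) λ j → x (t j)

  -- ⟨P[k]⟩^{⊗m}: finite formal R-linear combinations of basis tensors
  -- a₁ ⊗ ⋯ ⊗ a_m (a basis tensor = an m-tuple of subsets of [k]).
  -- Sym^m⟨P[k]⟩ is its space of S_m-coinvariants; an element of Sym^m is
  -- represented by any tensor in its class.
  Tensor : ℕ → ℕ → Set c
  Tensor k m = List (Carrier × (Fin m → Subset k))

  scale : ∀ {k m} → Carrier → Tensor k m → Tensor k m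
  scale r = map (λ { (c , x) → (r * c , x) })

  _∪⊗_ : ∀ {k m} → Tensor k m → Tensor k m → Tensor k m
  u ∪⊗ v = concatMap (λ { (c , x) → map (λ { (d , y) → (c * d , λ t → x t ∪ y t) }) v }) u

  act : ∀ {k m} → (Fin m → Fin m) → Tensor k m → Tensor k m
  act τ = map (λ { (c , x) → (c , λ t → x (τ t)) })

  ⟦_⟧ : ∀ {k m} → (Fin m → Subset k) → Tensor k m
  ⟦ a ⟧ = [ (1# , a) ]

  -- union on Sym^m:  ū ∪ v̄ = (1/m!) Σ_{τ ∈ S_m} class(u ∪ τ v);
  -- inv is the scalar 1/m!
  SymUnion : ∀ {k m} → Carrier → Tensor k m → Tensor k m → Tensor k m
  SymUnion {m = m} inv u v = scale inv (concatMap (λ τ → u ∪⊗ act τ v) (perms m))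

  bigUnion : ∀ {k m} → Carrier → (n : ℕ) → (Fin n → Tensor k m) → Tensor k m
  bigUnion inv zero    x = []
  bigUnion inv (suc p) x = go (x zero) p (λ i → x (suc i))
    where
    go : _ → (q : ℕ) → (Fin q → _) → _
    go acc zero    y = acc
    go acc (suc q) y = go (SymUnion inv acc (y zero)) q (λ i → y (suc i))

  -- e_l : Sym^m⟨P[k]⟩ → R, the linear map with
  -- e_l({a₁,…,a_m}) = e_l(μ(a₁),…,μ(a_m))  (well defined on coinvariants)
  eL : ∀ {k m} → (Subset k → Carrier) → ℕ → Tensor k m → Carrier
  eL μ l u = ΣL u λ { (c , x) → c * esym l (λ t → μ (x t)) }

{-# OPTIONS --safe #-}

-- By bilinearity, the iterated union of the classes {a^i_1,…,a^i_m} is (1/m!)^(n-1) times the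
-- sum, over σ ∈ {id} × S_m^(n-1), of the classes of the tuples t ↦ ⋃_i a^i_{σ_i(t)}.  Since e_l
-- is linear, it remains to evaluate e_l(μ(x_1),…,μ(x_m)) at such tuples: every factor
-- μ(⋃_i a^i_{σ_i(t_j)}) is expanded by inclusion–exclusion, and multiplying out the product over
-- j turns the choice of one nonempty index set per factor into the sum over f : [l] → P([n])∖{∅}.
-- Inclusion–exclusion is proved by induction on the number of sets, applying the induction
-- hypothesis both to μ and to its restriction μ(a ∩ _), which is again a measure.

module Submission where

open import Defs
open import Algebra.Bundles using (CommutativeRing)
open import Data.Nat using (ℕ; _≤_; _∸_; suc; zero; s≤s; z≤n; _!)
open import Data.Fin using (Fin; zero; suc)
open import Data.Fin.Subset using (Subset; ⋂; ⋃; ∣_∣; _∪_; _∩_; ∁; ⊥; ⊤; Nonempty)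
open import Data.Fin.Subset.Properties
  using ( ∣⊥∣≡0; nonempty?; _∈?_; drop-there
        ; ∩-comm; ∩-idem; ∩-zeroʳ; ∩-identityʳ; ∩-inverseʳ; ∩-distribˡ-∪; ∩-distribʳ-∪
        ; ∩-abs-∪; ∩-idempotentCommutativeMonoid
        ; ∪-assoc; ∪-idem; ∪-identityˡ; ∪-identityʳ; ∪-inverseʳ )
import Algebra.Properties.IdempotentCommutativeMonoid as IdempotentCommutativeMonoidProperties
open import Data.List using (List; []; _∷_; map; allFin; _++_; concatMap; filter; tabulate)
open import Data.List.Properties using (filter-++; filter-≐; map-tabulate; map-∘; foldr-map)
open import Data.Vec using (_∷_; there)
open import Data.Bool using (true; false)
open import Data.Product using (_,_)
open import Function using (_∘_)
open import Relation.Binary.Core using (_Preserves_⟶_)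
open import Relation.Binary.PropositionalEquality as ≡ using (_≡_; _≗_; cong)
open import Relation.Nullary using (does)
open import Relation.Unary using (Decidable; _≐_)
open import Level using (Level)

private
  variable
    a b c p : Level
    A : Set a
    B : Set b
    C : Set c

filter-map : {P : B → Set p} (P? : Decidable P) (f : A → B) (xs : List A) →
             filter P? (map f xs) ≡ map f (filter (P? ∘ f) xs)
filter-map P? f [] = ≡.refl
filter-map P? f (x ∷ xs) with does (P? (f x))
... | true  = cong (f x ∷_) (filter-map P? f xs)
... | false = filter-map P? f xs

filter-nonempty-true : ∀ {n} (ss : List (Subset n)) →
                       filter nonempty? (map (true ∷_) ss) ≡ map (true ∷_) ss
filter-nonempty-true []       = ≡.refl
filter-nonempty-true (s ∷ ss) = cong ((true ∷ s) ∷_) (filter-nonempty-true ss)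

Nonempty-false∷ : ∀ {n} → Nonempty {n} ≐ Nonempty ∘ (false ∷_)
Nonempty-false∷ = (λ { (i , i∈s) → suc i , there i∈s }) , (λ { (suc i , there i∈s) → i , i∈s })

filter-nonempty-false : ∀ {n} (ss : List (Subset n)) →
                        filter nonempty? (map (false ∷_) ss) ≡ map (false ∷_) (filter nonempty? ss)
filter-nonempty-false ss = ≡.trans (filter-map nonempty? (false ∷_) ss)
  (cong (map (false ∷_)) (≡.sym (filter-≐ nonempty? _ Nonempty-false∷ ss)))

nonemptySubsets-suc : ∀ n → nonemptySubsets (suc n)
                            ≡ map (true ∷_) (allSubsets n) ++ map (false ∷_) (nonemptySubsets n)
nonemptySubsets-suc n = ≡.trans
  (filter-++ nonempty? (map (true ∷_) (allSubsets n)) (map (false ∷_) (allSubsets n)))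
  (≡.cong₂ _++_ (filter-nonempty-true (allSubsets n)) (filter-nonempty-false (allSubsets n)))

filter-∈-tabulate-suc : ∀ {n} b (s : Subset n) → filter (_∈? (b ∷ s)) (tabulate suc) ≡ map suc (elems s)
filter-∈-tabulate-suc {n} b s = begin
  filter (_∈? (b ∷ s)) (tabulate suc)
    ≡⟨ cong (filter (_∈? (b ∷ s))) (map-tabulate (λ i → i) suc) ⟨
  filter (_∈? (b ∷ s)) (map suc (allFin n))
    ≡⟨ filter-map (_∈? (b ∷ s)) suc (allFin n) ⟩
  map suc (filter (λ i → suc i ∈? b ∷ s) (allFin n))
    ≡⟨ cong (map suc) (filter-≐ _ (_∈? s) (drop-there , there) (allFin n)) ⟩
  map suc (elems s)
    ∎
  where open ≡.≡-Reasoning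

module _ {k n : ℕ} (X : Fin (suc n) → Subset k) (s : Subset n) where

  ⋂-elems-true : ⋂ (map X (elems (true ∷ s))) ≡ X zero ∩ ⋂ (map (X ∘ suc) (elems s))
  ⋂-elems-true = ≡.trans (cong (λ is → X zero ∩ ⋂ (map X is)) (filter-∈-tabulate-suc true s))
                         (cong (λ Xs → X zero ∩ ⋂ Xs) (≡.sym (map-∘ (elems s))))

  ⋂-elems-false : ⋂ (map X (elems (false ∷ s))) ≡ ⋂ (map (X ∘ suc) (elems s))
  ⋂-elems-false = ≡.trans (cong (λ is → ⋂ (map X is)) (filter-∈-tabulate-suc false s))
                          (cong ⋂ (≡.sym (map-∘ (elems s))))

elems-⊥ : ∀ {n} → elems (⊥ {n}) ≡ []
elems-⊥ {zero}  = ≡.refl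
elems-⊥ {suc n} = ≡.trans (filter-∈-tabulate-suc false ⊥) (cong (map suc) elems-⊥)

module _ {r ℓ} (R : CommutativeRing r ℓ) where

  open CommutativeRing R hiding (zero)
  open Over R using (ΣL; ΠL; _^_; sgn; IsMeasure; esym; Tensor; scale; _∪⊗_; act; ⟦_⟧; SymUnion; bigUnion)
  open import Algebra.Properties.Ring ring
    using (-‿involutive; -‿distribˡ-*; -‿+-comm; -0#≈0#; +-identityˡ-unique)
  open import Algebra.Properties.CommutativeSemigroup +-commutativeSemigroup
    using (interchange; x∙yz≈y∙xz)
  open import Algebra.Properties.CommutativeSemigroup *-commutativeSemigroup
    using () renaming (x∙yz≈yx∙z to x*yz≈yx*z)
  open import Relation.Binary.Reasoning.Setoid setoid

  ΣL-cong : (xs : List A) {f g : A → Carrier} → (∀ x → f x ≈ g x) → ΣL xs f ≈ ΣL xs g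
  ΣL-cong []       f≈g = refl
  ΣL-cong (x ∷ xs) f≈g = +-cong (f≈g x) (ΣL-cong xs f≈g)

  ΣL-map : (g : B → A) (xs : List B) (f : A → Carrier) → ΣL (map g xs) f ≡ ΣL xs (f ∘ g)
  ΣL-map g xs f = foldr-map _ g 0# xs

  ΣL-++ : (xs ys : List A) (f : A → Carrier) → ΣL (xs ++ ys) f ≈ ΣL xs f + ΣL ys f
  ΣL-++ []       ys f = sym (+-identityˡ _)
  ΣL-++ (x ∷ xs) ys f = trans (+-congˡ (ΣL-++ xs ys f)) (sym (+-assoc _ _ _))

  ΣL-concatMap : (g : B → List A) (xs : List B) (f : A → Carrier) →
                 ΣL (concatMap g xs) f ≈ ΣL xs (λ x → ΣL (g x) f)
  ΣL-concatMap g []       f = refl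
  ΣL-concatMap g (x ∷ xs) f = trans (ΣL-++ (g x) (concatMap g xs) f) (+-congˡ (ΣL-concatMap g xs f))

  ΣL-zero : (xs : List A) → ΣL xs (λ _ → 0#) ≈ 0#
  ΣL-zero []       = refl
  ΣL-zero (x ∷ xs) = trans (+-congˡ (ΣL-zero xs)) (+-identityʳ 0#)

  ΣL-+ : (xs : List A) (f g : A → Carrier) → ΣL xs (λ x → f x + g x) ≈ ΣL xs f + ΣL xs g
  ΣL-+ []       f g = sym (+-identityʳ 0#)
  ΣL-+ (x ∷ xs) f g = trans (+-congˡ (ΣL-+ xs f g)) (interchange _ _ _ _)

  ΣL-neg : (xs : List A) (f : A → Carrier) → ΣL xs (λ x → - f x) ≈ - ΣL xs f
  ΣL-neg []       f = sym -0#≈0#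
  ΣL-neg (x ∷ xs) f = trans (+-congˡ (ΣL-neg xs f)) (-‿+-comm _ _)

  ΣL-distribˡ : (r : Carrier) (xs : List A) (f : A → Carrier) → r * ΣL xs f ≈ ΣL xs (λ x → r * f x)
  ΣL-distribˡ r []       f = zeroʳ r
  ΣL-distribˡ r (x ∷ xs) f = trans (distribˡ r _ _) (+-congˡ (ΣL-distribˡ r xs f))

  ΣL-distribʳ : (r : Carrier) (xs : List A) (f : A → Carrier) → ΣL xs f * r ≈ ΣL xs (λ x → f x * r)
  ΣL-distribʳ r []       f = zeroˡ r
  ΣL-distribʳ r (x ∷ xs) f = trans (distribʳ r _ _) (+-congˡ (ΣL-distribʳ r xs f))

  ΣL-*-ΣL : (xs : List A) (ys : List B) (f : A → Carrier) (g : B → Carrier) →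
            ΣL xs f * ΣL ys g ≈ ΣL xs (λ x → ΣL ys (λ y → f x * g y))
  ΣL-*-ΣL xs ys f g = trans (ΣL-distribʳ _ xs f) (ΣL-cong xs (λ x → ΣL-distribˡ (f x) ys g))

  ΣL-swap : (xs : List A) (ys : List B) (f : A → B → Carrier) →
            ΣL xs (λ x → ΣL ys (f x)) ≈ ΣL ys (λ y → ΣL xs (λ x → f x y))
  ΣL-swap []       ys f = sym (ΣL-zero ys)
  ΣL-swap (x ∷ xs) ys f = trans (+-congˡ (ΣL-swap xs ys f)) (sym (ΣL-+ ys (f x) _))

  ΣL-concatMap-map : (h : A → B → C) (xs : List A) (ys : List B) (f : C → Carrier) →
                     ΣL (concatMap (λ x → map (h x) ys) xs) f ≈ ΣL xs (λ x → ΣL ys (λ y → f (h x y)))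
  ΣL-concatMap-map h xs ys f =
    trans (ΣL-concatMap _ xs f) (ΣL-cong xs (λ x → reflexive (ΣL-map (h x) ys f)))

  ΠL-cong : (xs : List A) {f g : A → Carrier} → (∀ x → f x ≈ g x) → ΠL xs f ≈ ΠL xs g
  ΠL-cong []       f≈g = refl
  ΠL-cong (x ∷ xs) f≈g = *-cong (f≈g x) (ΠL-cong xs f≈g)

  ΠL-allFin-suc : ∀ l (h : Fin (suc l) → Carrier) →
                  ΠL (allFin (suc l)) h ≡ h zero * ΠL (allFin l) (h ∘ suc)
  ΠL-allFin-suc l h = cong (h zero *_)
    (≡.trans (cong (λ js → ΠL js h) (≡.sym (map-tabulate (λ j → j) suc))) (foldr-map _ suc 1# (allFin l)))

  ΠL-ΣL : (xs : List A) (l : ℕ) (g : Fin l → A → Carrier) →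
          ΠL (allFin l) (λ j → ΣL xs (g j)) ≈ ΣL (allFuns l xs) (λ f → ΠL (allFin l) (λ j → g j (f j)))
  ΠL-ΣL xs zero    g = sym (+-identityʳ 1#)
  ΠL-ΣL xs (suc l) g = begin
    ΠL (allFin (suc l)) (λ j → ΣL xs (g j))
      ≡⟨ ΠL-allFin-suc l _ ⟩
    ΣL xs (g zero) * ΠL (allFin l) (λ j → ΣL xs (g (suc j)))
      ≈⟨ *-congˡ (ΠL-ΣL xs l (g ∘ suc)) ⟩
    ΣL xs (g zero) * ΣL (allFuns l xs) (λ f → ΠL (allFin l) (λ j → g (suc j) (f j)))
      ≈⟨ ΣL-*-ΣL xs (allFuns l xs) (g zero) _ ⟩
    ΣL xs (λ x → ΣL (allFuns l xs) (λ f → g zero x * ΠL (allFin l) (λ j → g (suc j) (f j))))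
      ≈⟨ ΣL-concatMap-map _ xs (allFuns l xs) _ ⟨
    ΣL (allFuns (suc l) xs) (λ f → g zero (f zero) * ΠL (allFin l) (λ j → g (suc j) (f (suc j))))
      ≈⟨ ΣL-cong (allFuns (suc l) xs) (λ f → reflexive (ΠL-allFin-suc l _)) ⟨
    ΣL (allFuns (suc l) xs) (λ f → ΠL (allFin (suc l)) (λ j → g j (f j)))
      ∎

  IsMeasure-restrict : ∀ {k} {μ : Subset k → Carrier} → IsMeasure μ →
                       (C : Subset k) → IsMeasure (λ s → μ (C ∩ s))
  IsMeasure-restrict {μ = μ} μ-measure C s t s∩t≡⊥ = begin
    μ (C ∩ (s ∪ t))        ≡⟨ cong μ (∩-distribˡ-∪ C s t) ⟩
    μ ((C ∩ s) ∪ (C ∩ t))  ≈⟨ μ-measure (C ∩ s) (C ∩ t) disjoint ⟩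
    μ (C ∩ s) + μ (C ∩ t)  ∎
    where
    open IdempotentCommutativeMonoidProperties (∩-idempotentCommutativeMonoid _) using (∙-distrˡ-∙)
    disjoint : (C ∩ s) ∩ (C ∩ t) ≡ ⊥
    disjoint = ≡.trans (≡.sym (∙-distrˡ-∙ C s t)) (≡.trans (cong (C ∩_) s∩t≡⊥) (∩-zeroʳ C))

  module _ {k} {μ : Subset k → Carrier} (μ-measure : IsMeasure μ) where

    measure-⊥ : μ ⊥ ≈ 0#
    measure-⊥ = +-identityˡ-unique (μ ⊥) (μ ⊥) (begin
      μ ⊥ + μ ⊥  ≈⟨ μ-measure ⊥ ⊥ (∩-idem ⊥) ⟨
      μ (⊥ ∪ ⊥)  ≡⟨ cong μ (∪-idem ⊥) ⟩
      μ ⊥        ∎)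

    measure-split : ∀ Y X → μ Y ≈ μ (Y ∩ X) + μ (Y ∩ ∁ X)
    measure-split Y X = begin
      μ Y                      ≡⟨ cong μ (∩-identityʳ Y) ⟨
      μ (Y ∩ ⊤)                ≡⟨ cong (λ Z → μ (Y ∩ Z)) (∪-inverseʳ X) ⟨
      μ (Y ∩ (X ∪ ∁ X))        ≈⟨ IsMeasure-restrict μ-measure Y X (∁ X) (∩-inverseʳ X) ⟩
      μ (Y ∩ X) + μ (Y ∩ ∁ X)  ∎

    measure-∪ : ∀ X Y → μ (X ∪ Y) ≈ (μ X - μ (X ∩ Y)) + μ Y
    measure-∪ X Y = begin
      μ (X ∪ Y)
        ≈⟨ measure-split (X ∪ Y) X ⟩
      μ ((X ∪ Y) ∩ X) + μ ((X ∪ Y) ∩ ∁ X)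
        ≡⟨ ≡.cong₂ (λ P Q → μ P + μ Q) absorb restrict ⟩
      μ X + μ (Y ∩ ∁ X)
        ≈⟨ regroup _ _ _ ⟩
      (μ X - μ (X ∩ Y)) + (μ (X ∩ Y) + μ (Y ∩ ∁ X))
        ≡⟨ cong (λ Z → (μ X - μ (X ∩ Y)) + (μ Z + μ (Y ∩ ∁ X))) (∩-comm X Y) ⟩
      (μ X - μ (X ∩ Y)) + (μ (Y ∩ X) + μ (Y ∩ ∁ X))
        ≈⟨ +-congˡ (measure-split Y X) ⟨
      (μ X - μ (X ∩ Y)) + μ Y
        ∎
      where
      absorb : (X ∪ Y) ∩ X ≡ X
      absorb = ≡.trans (∩-comm (X ∪ Y) X) (∩-abs-∪ X Y)
      restrict : (X ∪ Y) ∩ ∁ X ≡ Y ∩ ∁ X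
      restrict = ≡.trans (∩-distribʳ-∪ (∁ X) X Y)
                         (≡.trans (cong (_∪ (Y ∩ ∁ X)) (∩-inverseʳ X)) (∪-identityˡ _))
      regroup : ∀ x y z → x + z ≈ (x - y) + (y + z)
      regroup x y z = sym (begin
        (x - y) + (y + z)    ≈⟨ +-assoc x (- y) (y + z) ⟩
        x + (- y + (y + z))  ≈⟨ +-congˡ (+-assoc (- y) y z) ⟨
        x + ((- y + y) + z)  ≈⟨ +-congˡ (+-congʳ (-‿inverseˡ y)) ⟩
        x + (0# + z)         ≈⟨ +-congˡ (+-identityˡ z) ⟩
        x + z                ∎)

  ΣL-allSubsets : ∀ n (w : Subset n → Carrier) → ΣL (allSubsets n) w ≈ w ⊥ + ΣL (nonemptySubsets n) w
  ΣL-allSubsets zero    w = refl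
  ΣL-allSubsets (suc n) w = begin
    ΣL (map (true ∷_) all ++ map (false ∷_) all) w
      ≈⟨ ΣL-++ (map (true ∷_) all) (map (false ∷_) all) w ⟩
    ΣL (map (true ∷_) all) w + ΣL (map (false ∷_) all) w
      ≡⟨ cong (ΣL (map (true ∷_) all) w +_) (ΣL-map (false ∷_) all w) ⟩
    ΣL (map (true ∷_) all) w + ΣL all (w ∘ (false ∷_))
      ≈⟨ +-congˡ (ΣL-allSubsets n (w ∘ (false ∷_))) ⟩
    ΣL (map (true ∷_) all) w + (w ⊥ + ΣL (nonemptySubsets n) (w ∘ (false ∷_)))
      ≈⟨ x∙yz≈y∙xz _ _ _ ⟩
    w ⊥ + (ΣL (map (true ∷_) all) w + ΣL (nonemptySubsets n) (w ∘ (false ∷_)))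
      ≡⟨ cong (λ x → w ⊥ + (ΣL (map (true ∷_) all) w + x)) (ΣL-map (false ∷_) (nonemptySubsets n) w) ⟨
    w ⊥ + (ΣL (map (true ∷_) all) w + ΣL (map (false ∷_) (nonemptySubsets n)) w)
      ≈⟨ +-congˡ (ΣL-++ (map (true ∷_) all) (map (false ∷_) (nonemptySubsets n)) w) ⟨
    w ⊥ + ΣL (map (true ∷_) all ++ map (false ∷_) (nonemptySubsets n)) w
      ≡⟨ cong (λ ss → w ⊥ + ΣL ss w) (nonemptySubsets-suc n) ⟨
    w ⊥ + ΣL (nonemptySubsets (suc n)) w
      ∎
    where all = allSubsets n

  inclusion-exclusion : ∀ {k n} {μ : Subset k → Carrier} → IsMeasure μ → (X : Fin n → Subset k) →
    μ (⋃ (tabulate X)) ≈ ΣL (nonemptySubsets n) (λ s → sgn (suc ∣ s ∣) * μ (⋂ (map X (elems s))))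
  inclusion-exclusion {n = zero}      μ-measure X = measure-⊥ μ-measure
  inclusion-exclusion {n = suc n} {μ} μ-measure X = begin
    μ (X zero ∪ U)
      ≈⟨ measure-∪ μ-measure (X zero) U ⟩
    (μ (X zero) - μ (X zero ∩ U)) + μ U
      ≈⟨ +-cong (sym alternating-sum) (inclusion-exclusion μ-measure (X ∘ suc)) ⟩
    ΣL (allSubsets n) (λ s → sgn ∣ s ∣ * μ (X zero ∩ ⋂′ s))
      + ΣL (nonemptySubsets n) (λ s → sgn (suc ∣ s ∣) * μ (⋂′ s))
      ≈⟨ +-cong (ΣL-cong (allSubsets n) (λ s → *-cong (-‿involutive _) (reflexive (cong μ (⋂-elems-true X s)))))
                (ΣL-cong (nonemptySubsets n) (λ s → *-congˡ (reflexive (cong μ (⋂-elems-false X s))))) ⟨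
    ΣL (allSubsets n) (h ∘ (true ∷_)) + ΣL (nonemptySubsets n) (h ∘ (false ∷_))
      ≡⟨ ≡.cong₂ _+_ (ΣL-map (true ∷_) (allSubsets n) h) (ΣL-map (false ∷_) (nonemptySubsets n) h) ⟨
    ΣL (map (true ∷_) (allSubsets n)) h + ΣL (map (false ∷_) (nonemptySubsets n)) h
      ≈⟨ ΣL-++ (map (true ∷_) (allSubsets n)) (map (false ∷_) (nonemptySubsets n)) h ⟨
    ΣL (map (true ∷_) (allSubsets n) ++ map (false ∷_) (nonemptySubsets n)) h
      ≡⟨ cong (λ ss → ΣL ss h) (nonemptySubsets-suc n) ⟨
    ΣL (nonemptySubsets (suc n)) h
      ∎
    where
    U : Subset _
    U = ⋃ (tabulate (X ∘ suc))
    ⋂′ : Subset n → Subset _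
    ⋂′ s = ⋂ (map (X ∘ suc) (elems s))
    h : Subset (suc n) → Carrier
    h s = sgn (suc ∣ s ∣) * μ (⋂ (map X (elems s)))

    empty-term : sgn ∣ ⊥ {n} ∣ * μ (X zero ∩ ⋂′ ⊥) ≈ μ (X zero)
    empty-term = begin
      sgn ∣ ⊥ {n} ∣ * μ (X zero ∩ ⋂′ ⊥)
        ≡⟨ ≡.cong₂ (λ i is → sgn i * μ (X zero ∩ ⋂ (map (X ∘ suc) is))) (∣⊥∣≡0 n) elems-⊥ ⟩
      1# * μ (X zero ∩ ⊤)  ≈⟨ *-identityˡ _ ⟩
      μ (X zero ∩ ⊤)       ≡⟨ cong μ (∩-identityʳ (X zero)) ⟩
      μ (X zero)           ∎

    alternating-sum : ΣL (allSubsets n) (λ s → sgn ∣ s ∣ * μ (X zero ∩ ⋂′ s))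
                      ≈ μ (X zero) - μ (X zero ∩ U)
    alternating-sum = begin
      ΣL (allSubsets n) (λ s → sgn ∣ s ∣ * μ (X zero ∩ ⋂′ s))
        ≈⟨ ΣL-allSubsets n _ ⟩
      sgn ∣ ⊥ {n} ∣ * μ (X zero ∩ ⋂′ ⊥)
        + ΣL (nonemptySubsets n) (λ s → sgn ∣ s ∣ * μ (X zero ∩ ⋂′ s))
        ≈⟨ +-cong empty-term (ΣL-cong (nonemptySubsets n) (λ s → sym (-‿involutive-*ˡ _ _))) ⟩
      μ (X zero) + ΣL (nonemptySubsets n) (λ s → - (sgn (suc ∣ s ∣) * μ (X zero ∩ ⋂′ s)))
        ≈⟨ +-congˡ (ΣL-neg (nonemptySubsets n) _) ⟩
      μ (X zero) - ΣL (nonemptySubsets n) (λ s → sgn (suc ∣ s ∣) * μ (X zero ∩ ⋂′ s))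
        ≈⟨ +-congˡ (-‿cong (inclusion-exclusion (IsMeasure-restrict μ-measure (X zero)) (X ∘ suc))) ⟨
      μ (X zero) - μ (X zero ∩ U)
        ∎
      where
      -‿involutive-*ˡ : ∀ x y → - (- x * y) ≈ x * y
      -‿involutive-*ˡ x y = trans (-‿cong (sym (-‿distribˡ-* x y))) (-‿involutive (x * y))

  esym-measure-⋃ : ∀ {k m n} {μ : Subset k → Carrier} → IsMeasure μ →
                   (l : ℕ) (X : Fin n → Fin m → Subset k) →
    esym l (λ t → μ (⋃ (tabulate (λ i → X i t))))
      ≈ ΣL (increasingTuples l m) (λ t →
          ΣL (allFuns l (nonemptySubsets n)) (λ f →
            ΠL (allFin l) (λ j → sgn (suc ∣ f j ∣) * μ (⋂ (map (λ i → X i (t j)) (elems (f j)))))))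
  esym-measure-⋃ {m = m} {n} μ-measure l X = ΣL-cong (increasingTuples l m) (λ t →
    trans (ΠL-cong (allFin l) (λ j → inclusion-exclusion μ-measure (λ i → X i (t j))))
          (ΠL-ΣL (nonemptySubsets n) l _))

  -- eL μ l is definitionally linear (λ x → esym l (μ ∘ x)).
  linear : ∀ {k m} → ((Fin m → Subset k) → Carrier) → Tensor k m → Carrier
  linear Φ u = ΣL u (λ (r , x) → r * Φ x)

  module _ {k m : ℕ} where

    linear-cong : {Φ Ψ : (Fin m → Subset k) → Carrier} (u : Tensor k m) →
                  (∀ x → Φ x ≈ Ψ x) → linear Φ u ≈ linear Ψ u
    linear-cong u Φ≈Ψ = ΣL-cong u (λ (r , x) → *-congˡ (Φ≈Ψ x))

    linear-⟦⟧ : (Φ : (Fin m → Subset k) → Carrier) (x : Fin m → Subset k) → linear Φ ⟦ x ⟧ ≈ Φ x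
    linear-⟦⟧ Φ x = trans (+-identityʳ _) (*-identityˡ _)

    linear-scale : (Φ : (Fin m → Subset k) → Carrier) (r : Carrier) (u : Tensor k m) →
                   linear Φ (scale r u) ≈ r * linear Φ u
    linear-scale Φ r []            = sym (zeroʳ r)
    linear-scale Φ r ((s , x) ∷ u) =
      trans (+-cong (*-assoc r s (Φ x)) (linear-scale Φ r u)) (sym (distribˡ r _ _))

    linear-∪⊗-⟦⟧ : (Φ : (Fin m → Subset k) → Carrier) (u : Tensor k m) (y : Fin m → Subset k) →
                   linear Φ (u ∪⊗ ⟦ y ⟧) ≈ linear (λ x → Φ (λ t → x t ∪ y t)) u
    linear-∪⊗-⟦⟧ Φ []            y = refl
    linear-∪⊗-⟦⟧ Φ ((r , x) ∷ u) y = +-cong (*-congʳ (*-identityʳ r)) (linear-∪⊗-⟦⟧ Φ u y)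

    linear-SymUnion-⟦⟧ : (inv : Carrier) (Φ : (Fin m → Subset k) → Carrier)
                         (u : Tensor k m) (y : Fin m → Subset k) →
      linear Φ (SymUnion inv u ⟦ y ⟧) ≈ inv * ΣL (perms m) (λ τ → linear (λ x → Φ (λ t → x t ∪ y (τ t))) u)
    linear-SymUnion-⟦⟧ inv Φ u y = begin
      linear Φ (SymUnion inv u ⟦ y ⟧)
        ≈⟨ linear-scale Φ inv (concatMap (λ τ → u ∪⊗ act τ ⟦ y ⟧) (perms m)) ⟩
      inv * linear Φ (concatMap (λ τ → u ∪⊗ act τ ⟦ y ⟧) (perms m))
        ≈⟨ *-congˡ (ΣL-concatMap (λ τ → u ∪⊗ act τ ⟦ y ⟧) (perms m) _) ⟩
      inv * ΣL (perms m) (λ τ → linear Φ (u ∪⊗ ⟦ y ∘ τ ⟧))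
        ≈⟨ *-congˡ (ΣL-cong (perms m) (λ τ → linear-∪⊗-⟦⟧ Φ u (y ∘ τ))) ⟩
      inv * ΣL (perms m) (λ τ → linear (λ x → Φ (λ t → x t ∪ y (τ t))) u)
        ∎

    ∪-permuted : ∀ {q} → (Fin q → Fin m → Subset k) → (Fin q → Fin m → Fin m) →
                 (Fin m → Subset k) → Fin m → Subset k
    ∪-permuted b ρ x t = x t ∪ ⋃ (tabulate (λ i → b i (ρ i t)))

    -- bigUnion accumulates the partial unions in its first argument, hence the arbitrary tensor u there.
    linear-bigUnion : (inv : Carrier) (Φ : (Fin m → Subset k) → Carrier) → Φ Preserves _≗_ ⟶ _≈_ →
      ∀ q (u : Tensor k m) (b : Fin q → Fin m → Subset k) →
      linear Φ (bigUnion inv (suc q) (λ { zero → u ; (suc i) → ⟦ b i ⟧ }))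
        ≈ (inv ^ q) * ΣL (allFuns q (perms m)) (λ ρ → linear (Φ ∘ ∪-permuted b ρ) u)
    linear-bigUnion inv Φ Φ-resp zero    u b = begin
      linear Φ u                                      ≈⟨ linear-cong u (λ x → Φ-resp (∪-identityʳ ∘ x)) ⟨
      linear (λ x → Φ (λ t → x t ∪ ⊥)) u              ≈⟨ *-identityˡ _ ⟨
      1# * linear (λ x → Φ (λ t → x t ∪ ⊥)) u         ≈⟨ *-congˡ (+-identityʳ _) ⟨
      1# * (linear (λ x → Φ (λ t → x t ∪ ⊥)) u + 0#)  ∎
    linear-bigUnion inv Φ Φ-resp (suc q) u b = begin
      linear Φ (bigUnion inv (suc q) (λ { zero → SymUnion inv u ⟦ b zero ⟧ ; (suc i) → ⟦ b (suc i) ⟧ }))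
        ≈⟨ linear-bigUnion inv Φ Φ-resp q (SymUnion inv u ⟦ b zero ⟧) (b ∘ suc) ⟩
      (inv ^ q) * ΣL ρs (λ ρ → linear (Φ ∘ ∪-permuted (b ∘ suc) ρ) (SymUnion inv u ⟦ b zero ⟧))
        ≈⟨ *-congˡ (ΣL-cong ρs (λ ρ → linear-SymUnion-⟦⟧ inv (Φ ∘ ∪-permuted (b ∘ suc) ρ) u (b zero))) ⟩
      (inv ^ q) * ΣL ρs (λ ρ → inv * ΣL (perms m) (λ τ →
                                  linear (λ x → Φ (∪-permuted (b ∘ suc) ρ (λ t → x t ∪ b zero (τ t)))) u))
        ≈⟨ *-congˡ (ΣL-cong ρs (λ ρ → *-congˡ (ΣL-cong (perms m) (λ τ →
             linear-cong u (λ x → Φ-resp (λ t → ∪-assoc (x t) _ _)))))) ⟩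
      (inv ^ q) * ΣL ρs (λ ρ → inv * ΣL (perms m) (λ τ → G τ ρ))
        ≈⟨ *-congˡ (ΣL-distribˡ inv ρs _) ⟨
      (inv ^ q) * (inv * ΣL ρs (λ ρ → ΣL (perms m) (λ τ → G τ ρ)))
        ≈⟨ x*yz≈yx*z _ _ _ ⟩
      (inv ^ suc q) * ΣL ρs (λ ρ → ΣL (perms m) (λ τ → G τ ρ))
        ≈⟨ *-congˡ (ΣL-swap ρs (perms m) _) ⟩
      (inv ^ suc q) * ΣL (perms m) (λ τ → ΣL ρs (λ ρ → G τ ρ))
        ≈⟨ *-congˡ (ΣL-concatMap-map _ (perms m) ρs _) ⟨
      (inv ^ suc q) * ΣL (allFuns (suc q) (perms m)) (λ ρ → linear (Φ ∘ ∪-permuted b ρ) u)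
        ∎
      where
      ρs = allFuns q (perms m)
      -- G τ ρ is, definitionally, the summand at the tuple τ ∷ ρ of allFuns (suc q) (perms m).
      G : (Fin m → Fin m) → (Fin q → Fin m → Fin m) → Carrier
      G τ ρ = linear (λ x → Φ (λ t → x t ∪ (b zero (τ t) ∪ ⋃ (tabulate (λ i → b (suc i) (ρ i t)))))) u

theorem4p7 : ∀ {c ℓ} (R : CommutativeRing c ℓ) →
  let open Over R in
  (k m n l : ℕ) → 1 ≤ k → 1 ≤ m → 1 ≤ n → 1 ≤ l → l ≤ m →
  (inv : Carrier) → inv * nat (m !) ≈ 1# →
  (μ : Subset k → Carrier) → IsMeasure μ →
  (a : Fin n → Fin m → Subset k) →
  eL μ l (bigUnion inv n (λ i → ⟦ a i ⟧))
    ≈ (inv ^ (n ∸ 1)) *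
      ΣL (sigmas n m) (λ σ →
        ΣL (increasingTuples l m) (λ t →
          ΣL (allFuns l (nonemptySubsets n)) (λ f →
            ΠL (allFin l) (λ j →
              sgn (suc ∣ f j ∣) *
              μ (⋂ (map (λ i → a i (σ i (t j))) (elems (f j))))))))
theorem4p7 R k m (suc q) l _ _ (s≤s z≤n) _ _ inv _ μ μ-measure a = begin
  linear R eₗ (bigUnion inv (suc q) (λ i → ⟦ a i ⟧))
    ≈⟨ linear-bigUnion R inv eₗ eₗ-resp q ⟦ a zero ⟧ (a ∘ suc) ⟩
  (inv ^ q) * ΣL ρs (λ ρ → linear R (eₗ ∘ ∪-permuted R (a ∘ suc) ρ) ⟦ a zero ⟧)
    ≈⟨ *-congˡ (ΣL-cong R ρs (λ ρ → linear-⟦⟧ R (eₗ ∘ ∪-permuted R (a ∘ suc) ρ) (a zero))) ⟩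
  (inv ^ q) * ΣL ρs (λ ρ → eₗ (∪-permuted R (a ∘ suc) ρ (a zero)))
    ≡⟨ cong ((inv ^ q) *_) (ΣL-map R _ ρs _) ⟨
  (inv ^ q) * ΣL (sigmas (suc q) m) (λ σ → eₗ (λ t → ⋃ (tabulate (λ i → a i (σ i t)))))
    ≈⟨ *-congˡ (ΣL-cong R (sigmas (suc q) m) (λ σ → esym-measure-⋃ R μ-measure l (λ i t → a i (σ i t)))) ⟩
  _ ∎
  where
  open CommutativeRing R hiding (zero)
  open Over R using (ΣL; _^_; ⟦_⟧; bigUnion; esym)
  open import Relation.Binary.Reasoning.Setoid setoid
  ρs = allFuns q (perms m)
  eₗ : (Fin m → Subset k) → Carrier
  eₗ x = esym l (μ ∘ x)
  eₗ-resp : eₗ Preserves _≗_ ⟶ _≈_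
  eₗ-resp x≗y = ΣL-cong R (increasingTuples l m) (λ t →
                 ΠL-cong R (allFin l) (λ j → reflexive (cong μ (x≗y (t j)))))
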